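{- Let $\lambda\in(0,1)$ with $\lambda\neq\frac{1}{2}$, and let $\Pi$ be a strongly $\lambda$-extendible property on a graph class $\mathcal{G}$. Then $\mathrm{ex}(K_3)\geq 1-2\lambda$, and if $\lambda>\frac{1}{2}$ then $\mathrm{ex}(K_3)=2-2\lambda$. In particular, $\mathrm{ex}(K_3)>0$.
   Context: $\mathcal{G}$ is a class of graphs whose edges may carry orientations and/or labels from a finite set (e.g. simple graphs, or oriented graphs). For $G\in\mathcal{G}$, $U(G)$ denotes the underlying simple graph; subgraphs inherit orientations/labels. A graph property $\Pi$ is a subset of $\mathcal{G}$ closed under isomorphism. For $\lambda\in(0,1)$, $\Pi$ is strongly $\lambda$-extendible if: (inclusiveness) every $G\in\mathcal{G}$ with $U(G)\in\{K_1,K_2\}$ is in $\Pi$; (block additivity) $G\in\Pi$ if and only if every block of $G$ is in $\Pi$; (strong $\lambda$-subgraph extension) for every $G\in\mathcal{G}$ and every partition $(U,W)$ of $V(G)$ with $G[U],G[W]\in\Pi$, there is a set $F$ of edges of $G$ between $U$ and $W$ with $|F|\geq\lambda|E(U,W)|$ such that $G-(E(U,W)\setminus F)\in\Pi$. For $G\in\mathcal{G}$, $\beta(G)$ is the maximum number of edges of a subgraph of $G$ belonging to $\Pi$, and $\mathrm{pt}(G)=\lambda|E(G)|+\frac{1-\lambda}{2}(|V(G)|-1)$. For a simple graph $K_j$, $\beta(K_j)$ is the minimum of $\beta(G)$ over all $G\in\mathcal{G}$ with $U(G)=K_j$, and $\mathrm{ex}(K_j)=\beta(K_j)-\big(\l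ambda\binom{j}{2}+\frac{1-\lambda}{2}(j-1)\big)$.
   Formalization: The parameter λ ranges over the rationals in (0,1). -}

module Defs where

open import Data.Nat using (ℕ; zero; suc; _<ᵇ_; _∸_)
open import Data.Nat.ListAction using (sum)
open import Data.Nat.Combinatorics using (_C_)
open import Data.Fin using (Fin; zero; suc; toℕ)
open import Data.Fin.Subset using (Subset; ∁; ⁅_⁆; _⊆_; Nonempty)
open import Data.Vec using ([]; _∷_; lookup)
open import Data.Maybe using (Maybe; nothing; is-just)
import Data.Maybe as Maybe
open import Data.Bool using (Bool; true; false; if_then_else_; _∧_; not; _xor_; T)
open import Data.List using (List; map; allFin; concatMap)
open import Data.Product using (Σ; _×_; _,_)
open import Data.Integer using (+_)
open import Data.Rational using (ℚ; _*_; _+_; _-_; _≤_; ½; 1ℚ) renaming (_/_ to _÷_)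
open import Function.Bundles using (_↔_; Inverse)
open import Function.Definitions using (Injective)
open import Relation.Binary.PropositionalEquality using (_≡_)

-- The graph class 𝒢: a finite set of edge decorations (labels and/or
-- orientations) Fin k, with an involution `rev` describing how the
-- decoration reads when the edge is traversed in the opposite direction
-- (identity for undirected labels, swapping for orientations).
record LabelSet : Set where
  field
    k      : ℕ
    rev    : Fin k → Fin k
    rev-rev : ∀ x → rev (rev x) ≡ x

Lab : LabelSet → Set
Lab Λ = Fin (LabelSet.k Λ)

-- Only the entries G i j with i < j are
-- meaningful (nothing = no edge, a label = an edge with that decoration,
-- read from i to j); the other entries are ignored (see E).
record Graph (Λ : LabelSet) (n : ℕ) : Set where
  constructor graph
  field
    raw : Fin n → Fin n → Maybe (Lab Λ)

open Graph public

E : ∀ {Λ n} → Graph Λ n → Fin n → Fin n → Maybe (Lab Λ)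
E {Λ} G i j with toℕ i <ᵇ toℕ j | toℕ j <ᵇ toℕ i
... | true  | _     = raw G i j
... | false | true  = Maybe.map (LabelSet.rev Λ) (raw G j i)
... | false | false = nothing

Adj : ∀ {Λ n} → Graph Λ n → Fin n → Fin n → Set
Adj G i j = T (is-just (E G i j))

pairs : ∀ n → List (Fin n × Fin n)
pairs n = concatMap (λ i → map (λ j → (i , j)) (allFin n)) (allFin n)

countPairs : ∀ {n} → (Fin n → Fin n → Bool) → ℕ
countPairs {n} p =
  sum (map (λ { (i , j) → if (toℕ i <ᵇ toℕ j) ∧ p i j then 1 else 0 }) (pairs n))

nEdges : ∀ {Λ n} → Graph Λ n → ℕ
nEdges G = countPairs (λ i j → is-just (E G i j))

Iso : ∀ {Λ n m} → Graph Λ n → Graph Λ m → Set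
Iso {n = n} {m} G H =
  Σ (Fin n ↔ Fin m) λ f →
    ∀ i j → E H (Inverse.to f i) (Inverse.to f j) ≡ E G i j

SubgraphOf : ∀ {Λ n m} → Graph Λ m → Graph Λ n → Set
SubgraphOf {n = n} {m = m} H G =
  Σ (Fin m → Fin n) λ f → Injective _≡_ _≡_ f ×
    (∀ i j → Adj H i j → E H i j ≡ E G (f i) (f j))

size : ∀ {n} → Subset n → ℕ
size []          = 0
size (true ∷ S)  = suc (size S)
size (false ∷ S) = size S

enum : ∀ {n} (S : Subset n) → Fin (size S) → Fin n
enum (true ∷ S)  zero    = zero
enum (true ∷ S)  (suc i) = suc (enum S i)
enum (false ∷ S) i       = suc (enum S i)

induced : ∀ {Λ n} → Graph Λ n → (S : Subset n) → Graph Λ (size S)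
induced G S = graph (λ i j → E G (enum S i) (enum S j))

data Reach {Λ n} (G : Graph Λ n) : Fin n → Fin n → Set where
  here : ∀ {i} → Reach G i i
  step : ∀ {i j l} → Adj G i j → Reach G j l → Reach G i l

Connected : ∀ {Λ n} → Graph Λ n → Set
Connected G = ∀ i j → Reach G i j

deleteVertex : ∀ {Λ n} → Graph Λ n → (v : Fin n) → Graph Λ (size (∁ ⁅ v ⁆))
deleteVertex G v = induced G (∁ ⁅ v ⁆)

-- for a connected graph: v is a cut vertex iff G - v is disconnected
NoCutVertex : ∀ {Λ n} → Graph Λ n → Set
NoCutVertex G = ∀ v → Connected (deleteVertex G v)

BlockCandidate : ∀ {Λ n} → Graph Λ n → Subset n → Set
BlockCandidate G S =
  Nonempty S × Connected (induced G S) × NoCutVertex (induced G S)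

-- blocks = maximal connected subgraphs without a cut vertex (these are
-- always induced subgraphs)
IsBlock : ∀ {Λ n} → Graph Λ n → Subset n → Set
IsBlock G S =
  BlockCandidate G S × (∀ T → S ⊆ T → BlockCandidate G T → T ⊆ S)

Property : LabelSet → Set₁
Property Λ = ∀ {n} → Graph Λ n → Set

IsoClosed : ∀ {Λ} → Property Λ → Set
IsoClosed {Λ} Π = ∀ {n m} (G : Graph Λ n) (H : Graph Λ m) → Iso G H → Π G → Π H

Inclusive : ∀ {Λ} → Property Λ → Set
Inclusive {Λ} Π =
  (∀ (G : Graph Λ 1) → Π G) ×
  (∀ (G : Graph Λ 2) → Adj G zero (suc zero) → Π G)

BlockAdditive : ∀ {Λ} → Property Λ → Set
BlockAdditive {Λ} Π = ∀ {n} (G : Graph Λ n) →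
  (Π G → ∀ S → IsBlock G S → Π (induced G S)) ×
  ((∀ S → IsBlock G S → Π (induced G S)) → Π G)

crossing : ∀ {n} → Subset n → Fin n → Fin n → Bool
crossing U i j = lookup U i xor lookup U j

nCross : ∀ {Λ n} → Graph Λ n → Subset n → ℕ
nCross G U = countPairs (λ i j → crossing U i j ∧ is-just (E G i j))

-- F ⊆ E(U,W) given by the selector `keep` (on pairs i < j); |F|
nKept : ∀ {Λ n} → Graph Λ n → Subset n → (Fin n → Fin n → Bool) → ℕ
nKept G U keep =
  countPairs (λ i j → crossing U i j ∧ is-just (E G i j) ∧ keep i j)

removeCrossExcept : ∀ {Λ n} → Graph Λ n → Subset n → (Fin n → Fin n → Bool) → Graph Λ n
removeCrossExcept G U keep = graph λ i j →
  if crossing U i j ∧ not (keep i j) then nothing else E G i j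

ℕtoℚ : ℕ → ℚ
ℕtoℚ m = (+ m) ÷ 1

StrongSubgraphExtension : ∀ {Λ} → ℚ → Property Λ → Set
StrongSubgraphExtension {Λ} lam Π =
  ∀ {n} (G : Graph Λ n) (U : Subset n) → Nonempty U → Nonempty (∁ U) →
    Π (induced G U) → Π (induced G (∁ U)) →
    Σ (Fin n → Fin n → Bool) λ keep →
      (lam * ℕtoℚ (nCross G U) ≤ ℕtoℚ (nKept G U keep)) ×
      Π (removeCrossExcept G U keep)

StronglyExtendible : ∀ {Λ} → ℚ → Property Λ → Set
StronglyExtendible lam Π =
  IsoClosed Π × Inclusive Π × BlockAdditive Π × StrongSubgraphExtension lam Π

IsBeta : ∀ {Λ n} → Property Λ → Graph Λ n → ℕ → Set
IsBeta {Λ} Π G b =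
  (Σ ℕ λ m → Σ (Graph Λ m) λ H → SubgraphOf H G × Π H × nEdges H ≡ b) ×
  (∀ m (H : Graph Λ m) → SubgraphOf H G → Π H → nEdges H Data.Nat.≤ b)

IsComplete : ∀ {Λ j} → Graph Λ j → Set
IsComplete G = ∀ i l → i Relation.Binary.PropositionalEquality.≢ l → Adj G i l

IsBetaK : ∀ Λ → Property Λ → ℕ → ℕ → Set
IsBetaK Λ Π j b =
  (Σ (Graph Λ j) λ G → IsComplete G × IsBeta Π G b) ×
  (∀ (G : Graph Λ j) → IsComplete G → ∀ b' → IsBeta Π G b' → b Data.Nat.≤ b')

pt : ℚ → ℕ → ℕ → ℚ
pt lam v e = lam * ℕtoℚ e + ((1ℚ - lam) * ½) * ℕtoℚ (v ∸ 1)

exK : ℚ → ℕ → ℕ → ℚ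
exK lam j b = ℕtoℚ b - pt lam j (j C 2)

-- Split a triangle G into the vertex 0 and the edge 12.  Both sides are in Π by
-- inclusiveness, so strong extension keeps k ≥ 2λ of the two crossing edges and
-- yields a Π-subgraph of G with k + 1 edges; hence k + 1 ≤ β(G) ≤ 3.  Since
-- λ > 0 forces k ≥ 1 and λ > ½ forces k ≥ 2, β(G) ∈ {2, 3} with β(G) = 3 when
-- λ > ½, and ex(K₃) = β − (1 + 2λ) is then 1 − 2λ or 2 − 2λ.  This holds for
-- every triangle G.
module Submission where

open import Defs
open import Data.Nat using (ℕ)
open import Data.Product using (_×_)
open import Data.Rational using (ℚ; 0ℚ; 1ℚ; ½; _<_; _≤_; _-_; _*_)
open import Relation.Binary.PropositionalEquality using (_≡_; _≢_)

open import Data.Bool using (Bool; true; false; T; not; if_then_else_; _∧_)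
open import Data.Bool.Properties using (∧-identityʳ; ∧-zeroʳ)
open import Data.Empty using (⊥-elim)
open import Data.Fin using (Fin; toℕ; #_)
open import Data.Fin.Properties using (injective⇒≤)
open import Data.Fin.Subset using (Subset; ⁅_⁆; ∁)
open import Data.Integer as ℤ using (+_)
import Data.Integer.Properties as ℤ
open import Data.Maybe using (Maybe; just; nothing; is-just)
import Data.Maybe as Maybe
open import Data.Nat as ℕ using (suc; _<ᵇ_; z≤n; s≤s)
import Data.Nat.Properties as ℕ
open import Data.Nat.Coprimality using (1-coprimeTo) renaming (sym to coprime-sym)
open import Data.Product using (Σ; _,_; proj₁; proj₂)
open import Data.Rational using (mkℚ; *≤*; -_)
import Data.Rational.Properties as ℚ
open import Data.Rational.Solver using (module +-*-Solver)
open import Data.Vec using (here; there)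
open import Function using (id)
open import Relation.Binary.Definitions using (tri<; tri≈; tri>)
open import Relation.Binary.PropositionalEquality
  using (refl; sym; trans; cong; cong₂; subst; subst₂)

𝟙 : Bool → ℕ
𝟙 b = if b then 1 else 0

𝟙≤1 : ∀ b → 𝟙 b ℕ.≤ 1
𝟙≤1 true  = s≤s z≤n
𝟙≤1 false = z≤n

𝟙-T : ∀ {b} → T b → 𝟙 b ≡ 1
𝟙-T {true} _ = refl

is-just-unless : ∀ {A : Set} b (x : Maybe A) →
  is-just (if not b then nothing else x) ≡ is-just x ∧ b
is-just-unless true  x = sym (∧-identityʳ (is-just x))
is-just-unless false x = sym (∧-zeroʳ (is-just x))

unless-just : ∀ {A : Set} b (x : Maybe A) → T (is-just (if b then nothing else x)) →
  (if b then nothing else x) ≡ x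
unless-just false x _ = refl

T-is-just-map⁻ : ∀ {A B : Set} {f : A → B} (x : Maybe A) →
  T (is-just (Maybe.map f x)) → T (is-just x)
T-is-just-map⁻ (just _) t = t

ℕtoℚ≡mkℚ : ∀ k → ℕtoℚ k ≡ mkℚ (+ k) 0 (coprime-sym (1-coprimeTo k))
ℕtoℚ≡mkℚ k = ℚ.normalize-coprime (coprime-sym (1-coprimeTo k))

ℕtoℚ-mono-≤ : ∀ {m n} → m ℕ.≤ n → ℕtoℚ m ≤ ℕtoℚ n
ℕtoℚ-mono-≤ {m} {n} m≤n rewrite ℕtoℚ≡mkℚ m | ℕtoℚ≡mkℚ n =
  *≤* (subst₂ ℤ._≤_ (sym (ℤ.*-identityʳ (+ m))) (sym (ℤ.*-identityʳ (+ n))) (ℤ.+≤+ m≤n))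

ℕtoℚ-cancel-< : ∀ {m n} → ℕtoℚ m < ℕtoℚ n → m ℕ.< n
ℕtoℚ-cancel-< m<n = ℕ.≰⇒> λ n≤m → ℚ.<-irrefl refl (ℚ.<-≤-trans m<n (ℕtoℚ-mono-≤ n≤m))

p<q⇒0<q-p : ∀ {p q} → p < q → 0ℚ < q - p
p<q⇒0<q-p {p} {q} p<q = subst (_< q - p) (ℚ.+-inverseʳ p) (ℚ.+-monoˡ-< (- p) p<q)

module _ {Λ : LabelSet} where

  subgraph-order-≤ : ∀ {m n} {H : Graph Λ m} {G : Graph Λ n} → SubgraphOf H G → m ℕ.≤ n
  subgraph-order-≤ (_ , injective , _) = injective⇒≤ injective

  countPairs-≤-3 : ∀ {m} → m ℕ.≤ 3 → (p : Fin m → Fin m → Bool) → countPairs p ℕ.≤ 3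
  countPairs-≤-3 {0} _ p = z≤n
  countPairs-≤-3 {1} _ p = z≤n
  countPairs-≤-3 {2} _ p = ℕ.+-mono-≤ (𝟙≤1 _) z≤n
  countPairs-≤-3 {3} _ p =
    ℕ.+-mono-≤ (𝟙≤1 (p (# 0) (# 1)))
      (ℕ.+-mono-≤ (𝟙≤1 (p (# 0) (# 2)))
        (ℕ.+-mono-≤ (𝟙≤1 (p (# 1) (# 2))) z≤n))
  countPairs-≤-3 {suc (suc (suc (suc _)))} (s≤s (s≤s (s≤s ())))

  β-≤-3 : ∀ {Π : Property Λ} {b} (G : Graph Λ 3) → IsBeta Π G b → b ℕ.≤ 3
  β-≤-3 G ((m , H , H⊆G , _ , refl) , _) =
    countPairs-≤-3 (subgraph-order-≤ H⊆G) (λ i j → is-just (E H i j))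

  subgraph-of-raw : ∀ {n} (H G : Graph Λ n) →
    (∀ i j → T (is-just (raw H i j)) → raw H i j ≡ E G i j) → SubgraphOf H G
  subgraph-of-raw H G agree = id , id , E-agree
    where
    E-agree : ∀ i j → Adj H i j → E H i j ≡ E G i j
    E-agree i j adj with toℕ i <ᵇ toℕ j | toℕ j <ᵇ toℕ i | agree i j | agree j i
    ... | true  | _     | agree-ij | _        = agree-ij adj
    ... | false | true  | _        | agree-ji =
      cong (Maybe.map (LabelSet.rev Λ)) (agree-ji (T-is-just-map⁻ (raw H j i) adj))
    ... | false | false | _        | _        = refl

  removeCrossExcept-subgraph : ∀ {n} (G : Graph Λ n) U keep →
    SubgraphOf (removeCrossExcept G U keep) G
  removeCrossExcept-subgraph G U keep = subgraph-of-raw _ G λ i j →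
    unless-just (crossing U i j ∧ not (keep i j)) (E G i j)

module Triangle {Λ : LabelSet} (G : Graph Λ 3) (complete : IsComplete G) where

  apex : Subset 3
  apex = ⁅ # 0 ⁆

  nCross-apex : nCross G apex ≡ 2
  nCross-apex = cong₂ (λ x y → x ℕ.+ (y ℕ.+ 0))
    (𝟙-T (complete (# 0) (# 1) λ ())) (𝟙-T (complete (# 0) (# 2) λ ()))

  nEdges-removeCrossExcept-apex : ∀ keep →
    nEdges (removeCrossExcept G apex keep) ≡ suc (nKept G apex keep)
  nEdges-removeCrossExcept-apex keep =
    edges-01-02-12 (cong 𝟙 (is-just-unless (keep (# 0) (# 1)) (E G (# 0) (# 1))))
                   (cong 𝟙 (is-just-unless (keep (# 0) (# 2)) (E G (# 0) (# 2))))
                   (𝟙-T (complete (# 1) (# 2) λ ()))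
    where
    edges-01-02-12 : ∀ {a a′ b b′ c} → a ≡ a′ → b ≡ b′ → c ≡ 1 →
      a ℕ.+ (b ℕ.+ (c ℕ.+ 0)) ≡ suc (a′ ℕ.+ (b′ ℕ.+ 0))
    edges-01-02-12 {a} {b = b} refl refl refl =
      trans (cong (a ℕ.+_) (ℕ.+-suc b 0)) (ℕ.+-suc a (b ℕ.+ 0))

module _ {Λ : LabelSet} {lam : ℚ} {Π : Property Λ}
         (inclusive : Inclusive Π) (extend : StrongSubgraphExtension lam Π) where

  triangle-kept-edges : (G : Graph Λ 3) → IsComplete G → ∀ {b} → IsBeta Π G b →
    Σ ℕ λ k → lam * ℕtoℚ 2 ≤ ℕtoℚ k × suc k ℕ.≤ b
  triangle-kept-edges G complete {b} (_ , maximal) =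
    nKept G apex keep ,
    subst (λ c → lam * ℕtoℚ c ≤ ℕtoℚ (nKept G apex keep)) nCross-apex enough-kept ,
    subst (ℕ._≤ b) (nEdges-removeCrossExcept-apex keep)
      (maximal 3 _ (removeCrossExcept-subgraph G apex keep) G′∈Π)
    where
    open Triangle G complete
    extension = extend G apex (# 0 , here) (# 1 , there here)
                  (proj₁ inclusive (induced G apex))
                  (proj₂ inclusive (induced G (∁ apex)) (complete (# 1) (# 2) λ ()))
    keep = proj₁ extension
    enough-kept = proj₁ (proj₂ extension)
    G′∈Π = proj₂ (proj₂ extension)

  triangle-β-bounds : 0ℚ < lam → (G : Graph Λ 3) → IsComplete G → ∀ {b} → IsBeta Π G b →
    2 ℕ.≤ b × (½ < lam → b ≡ 3)
  triangle-β-bounds 0<lam G complete β[G]≡b with triangle-kept-edges G complete β[G]≡b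
  ... | k , enough-kept , k<b =
    ℕ.≤-trans (s≤s (kept-above 0ℚ 0<lam refl)) k<b ,
    λ ½<lam → ℕ.≤-antisym (β-≤-3 G β[G]≡b) (ℕ.≤-trans (s≤s (kept-above ½ ½<lam refl)) k<b)
    where
    kept-above : ∀ c {j} → c < lam → c * ℕtoℚ 2 ≡ ℕtoℚ j → j ℕ.< k
    kept-above c c<lam c·2≡j = ℕtoℚ-cancel-<
      (subst (_< ℕtoℚ k) c·2≡j (ℚ.<-≤-trans (ℚ.*-monoˡ-<-pos (ℕtoℚ 2) c<lam) enough-kept))

module _ (lam : ℚ) where
  open +-*-Solver

  exK-3-2 : exK lam 3 2 ≡ 1ℚ - ℕtoℚ 2 * lam
  exK-3-2 = solve 1 (λ x →
      con (ℕtoℚ 2) :- (x :* con (ℕtoℚ 3) :+ ((con 1ℚ :- x) :* con ½) :* con (ℕtoℚ 2))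
        := con 1ℚ :- con (ℕtoℚ 2) :* x) refl lam

  exK-3-3 : exK lam 3 3 ≡ ℕtoℚ 2 - ℕtoℚ 2 * lam
  exK-3-3 = solve 1 (λ x →
      con (ℕtoℚ 3) :- (x :* con (ℕtoℚ 3) :+ ((con 1ℚ :- x) :* con ½) :* con (ℕtoℚ 2))
        := con (ℕtoℚ 2) :- con (ℕtoℚ 2) :* x) refl lam

  exK-3-≥ : ∀ {b} → 2 ℕ.≤ b → b ℕ.≤ 3 → 1ℚ - ℕtoℚ 2 * lam ≤ exK lam 3 b
  exK-3-≥ {0} () _
  exK-3-≥ {1} (s≤s ()) _
  exK-3-≥ {2} _ _ = ℚ.≤-reflexive (sym exK-3-2)
  exK-3-≥ {3} _ _ = subst (1ℚ - ℕtoℚ 2 * lam ≤_) (sym exK-3-3)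
    (ℚ.+-monoˡ-≤ (- (ℕtoℚ 2 * lam)) (ℕtoℚ-mono-≤ {1} {2} (s≤s z≤n)))
  exK-3-≥ {suc (suc (suc (suc _)))} _ (s≤s (s≤s (s≤s ())))

mainTheorem1 : (Λ : LabelSet) (lam : ℚ) → 0ℚ < lam → lam < 1ℚ → lam ≢ ½ →
    (Π : Property Λ) → StronglyExtendible lam Π →
    (b : ℕ) → IsBetaK Λ Π 3 b →
    (1ℚ - ℕtoℚ 2 * lam ≤ exK lam 3 b) ×
    (½ < lam → exK lam 3 b ≡ ℕtoℚ 2 - ℕtoℚ 2 * lam) ×
    (0ℚ < exK lam 3 b)
mainTheorem1 Λ lam 0<lam lam<1 lam≢½ Π (_ , inclusive , _ , extend) b
  ((G , complete , β[G]≡b) , _) = excess-≥ , excess-large , excess-pos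
  where
  bounds = triangle-β-bounds inclusive extend 0<lam G complete β[G]≡b

  excess-≥ : 1ℚ - ℕtoℚ 2 * lam ≤ exK lam 3 b
  excess-≥ = exK-3-≥ lam (proj₁ bounds) (β-≤-3 G β[G]≡b)

  excess-large : ½ < lam → exK lam 3 b ≡ ℕtoℚ 2 - ℕtoℚ 2 * lam
  excess-large ½<lam = trans (cong (exK lam 3) (proj₂ bounds ½<lam)) (exK-3-3 lam)

  excess-pos : 0ℚ < exK lam 3 b
  excess-pos with ℚ.<-cmp lam ½
  ... | tri< lam<½ _ _ = ℚ.<-≤-trans (p<q⇒0<q-p (ℚ.*-monoʳ-<-pos (ℕtoℚ 2) lam<½)) excess-≥
  ... | tri≈ _ lam≡½ _ = ⊥-elim (lam≢½ lam≡½)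
  ... | tri> _ _ ½<lam = subst (0ℚ <_) (sym (excess-large ½<lam))
                           (p<q⇒0<q-p (ℚ.*-monoʳ-<-pos (ℕtoℚ 2) lam<1))
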